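{- Let $v\in S_n$ and let $i$ be the last ascent of $v$. Then the rightmost and (among boxes in that column) southmost box of $D(v)$ lies in column $i$, and the canonical labeling of $D(v)$ fills that box with the label $i$.
   Context: Positions $(a,b)$ mean row $a$ from the bottom, column $b$ from the left. The Rothe diagram is $D(v)=\{(a,b): a<n-v(b)+1,\ b<v^{ -1}(n-a+1)\}$. The canonical labeling of $D(v)$ fills the $t$ boxes in row $a$ of $D(v)$, from left to right, with the labels $a,a+1,\dots,a+t-1$. The last ascent of $v$ is the largest $i$ with $v(i)<v(i+1)$. -}

module Defs where

open import Data.Nat using (ℕ; suc; _∸_; _+_; _<_; _≤_; _<?_)
open import Data.Fin using (Fin; toℕ; opposite)
open import Data.Fin.Permutation using (Permutation′; _⟨$⟩ʳ_; _⟨$⟩ˡ_)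
open import Data.List using (List; length; filter; allFin)
open import Data.Product using (Σ; _×_)
open import Relation.Nullary using (Dec)
open import Relation.Nullary.Decidable using (_×-dec_)
open import Relation.Binary.PropositionalEquality using (_≡_)

-- An element k : Fin n stands for the 1-based number  toℕ k + 1.
-- A row index r : Fin n stands for row  a = toℕ r + 1  (counted from the bottom),
-- a column index c : Fin n stands for column  b = toℕ c + 1  (from the left).

num : ∀ {n} → Fin n → ℕ
num k = suc (toℕ k)

val : ∀ {n} → Permutation′ n → Fin n → ℕ
val v c = num (v ⟨$⟩ʳ c)

-- 1-based value v^{-1}(n - a + 1), where a = num r; note num (opposite r) = n - a + 1.
invAtTop : ∀ {n} → Permutation′ n → Fin n → ℕ
invAtTop v r = num (v ⟨$⟩ˡ opposite r)

InD : ∀ {n} → Permutation′ n → Fin n → Fin n → Set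
InD {n} v r c = (num r < (n ∸ val v c) + 1) × (num c < invAtTop v r)

InD? : ∀ {n} (v : Permutation′ n) r c → Dec (InD v r c)
InD? {n} v r c = (num r <? (n ∸ val v c) + 1) ×-dec (num c <? invAtTop v r)

boxesLeft : ∀ {n} → Permutation′ n → Fin n → Fin n → ℕ
boxesLeft {n} v r c =
  length (filter (λ c′ → (toℕ c′ <? toℕ c) ×-dec InD? v r c′) (allFin n))

-- Canonical labeling: the t boxes of row a get labels a, a+1, ..., a+t-1 from
-- left to right; so a box in row a with k boxes to its left gets label a + k.
canonicalLabel : ∀ {n} → Permutation′ n → Fin n → Fin n → ℕ
canonicalLabel v r c = num r + boxesLeft v r c

IsAscent : ∀ {n} → Permutation′ n → Fin n → Set
IsAscent {n} v c = Σ (Fin n) (λ d → (toℕ d ≡ suc (toℕ c)) × (val v c < val v d))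

IsLastAscent : ∀ {n} → Permutation′ n → Fin n → Set
IsLastAscent {n} v c = IsAscent v c × (∀ (c′ : Fin n) → IsAscent v c′ → toℕ c′ ≤ toℕ c)

module Submission where

-- The boxes of D(v) are the pairs (row of the dot in column q, c) with c < q and v(c) < v(q).
-- Beyond its last ascent i, v is decreasing, so no box lies right of column i, and the lowest
-- box of column i is the one with q = i+1, in row a = n - v(i+1) + 1.  Its label is a + k,
-- where k counts the c < i with v(c) < v(i+1): exactly v(i+1) - 1 columns have such values,
-- and of the n - i + 1 columns c ≥ i all but i+1 do, so k = v(i+1) - 1 - (n - i) and a + k = i.

open import Defs
open import Data.Nat using (ℕ; zero; suc; _+_; _∸_; _≤_; _<_; _≤′_; ≤′-refl; ≤′-step; s≤s; s<s; s<s⁻¹; _<?_)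
open import Data.Nat.Properties hiding (_≟_; suc-injective)
import Data.Nat.Properties as ℕₚ
open import Data.Fin using (Fin; zero; suc; toℕ; fromℕ<; opposite)
open import Data.Fin.Properties using (toℕ<n; toℕ-fromℕ<; toℕ-injective; suc-injective; opposite-prop; opposite-involutive; _≟_)
open import Data.Fin.Permutation using (Permutation′; _⟨$⟩ʳ_; _⟨$⟩ˡ_; inverseˡ; inverseʳ)
open import Data.Bool using (true; false; if_then_else_)
open import Data.List using (length; filter; tabulate)
open import Data.Product using (Σ; _×_; _,_; proj₁; proj₂; swap)
open import Data.Sum using (inj₁; inj₂)
open import Data.Empty using (⊥-elim)
open import Function using (_∘_; _⇔_; mk⇔; Equivalence; Injection)
open import Function.Properties.Inverse using (↔⇒↣)
open import Relation.Nullary using (Dec; does; yes; no; ¬_)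
open import Relation.Nullary.Decidable using (does-⇔)
open import Relation.Unary using (Pred; Decidable)
open import Relation.Unary.Properties using (∁?; _∩?_)
open import Relation.Binary.PropositionalEquality
open import Algebra.Properties.CommutativeMonoid.Sum +-0-commutativeMonoid using (sum; sum-cong-≗; sum-permute; ∑-distrib-+)

open Equivalence using (to; from)

indicator : ∀ {a} {A : Set a} → Dec A → ℕ
indicator a? = if does a? then 1 else 0

count : ∀ {n ℓ} {P : Pred (Fin n) ℓ} → Decidable P → ℕ
count P? = sum (indicator ∘ P?)

length-filter-tabulate : ∀ {n a ℓ} {A : Set a} {P : Pred A ℓ} (P? : Decidable P) (g : Fin n → A) →
  length (filter P? (tabulate g)) ≡ count (P? ∘ g)
length-filter-tabulate {zero} P? g = refl
length-filter-tabulate {suc n} P? g with P? (g zero)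
... | yes _ = cong suc (length-filter-tabulate P? (g ∘ suc))
... | no _ = length-filter-tabulate P? (g ∘ suc)

count-cong : ∀ {n ℓ₁ ℓ₂} {P : Pred (Fin n) ℓ₁} {Q : Pred (Fin n) ℓ₂} (P? : Decidable P) (Q? : Decidable Q) →
  (∀ c → P c ⇔ Q c) → count P? ≡ count Q?
count-cong P? Q? P⇔Q = sum-cong-≗ (λ c → cong (λ b → if b then 1 else 0) (does-⇔ (P⇔Q c) (P? c) (Q? c)))

count-permute : ∀ {n ℓ} {P : Pred (Fin n) ℓ} (P? : Decidable P) (π : Permutation′ n) →
  count (P? ∘ (π ⟨$⟩ʳ_)) ≡ count P?
count-permute P? π = sym (sum-permute (indicator ∘ P?) π)

count-partition : ∀ {n ℓ₁ ℓ₂} {P : Pred (Fin n) ℓ₁} {Q : Pred (Fin n) ℓ₂} (P? : Decidable P) (Q? : Decidable Q) →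
  count P? ≡ count (P? ∩? Q?) + count (P? ∩? ∁? Q?)
count-partition P? Q? = trans (sum-cong-≗ split) (∑-distrib-+ (indicator ∘ (P? ∩? Q?)) (indicator ∘ (P? ∩? ∁? Q?)))
  where
  split : ∀ c → indicator (P? c) ≡ indicator ((P? ∩? Q?) c) + indicator ((P? ∩? ∁? Q?) c)
  split c with does (P? c) | does (Q? c)
  ... | true | true = refl
  ... | true | false = refl
  ... | false | _ = refl

count-∁ : ∀ {n ℓ} {P : Pred (Fin n) ℓ} (P? : Decidable P) → count P? + count (∁? P?) ≡ n
count-∁ {zero} P? = refl
count-∁ {suc n} P? with does (P? zero)
... | true = cong suc (count-∁ (P? ∘ suc))
... | false = trans (+-suc _ _) (cong suc (count-∁ (P? ∘ suc)))

count-∅ : ∀ {n ℓ} {P : Pred (Fin n) ℓ} (P? : Decidable P) → (∀ c → ¬ P c) → count P? ≡ 0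
count-∅ {zero} P? ∅ = refl
count-∅ {suc n} P? ∅ with P? zero
... | yes p = ⊥-elim (∅ zero p)
... | no _ = count-∅ (P? ∘ suc) (∅ ∘ suc)

count-toℕ< : ∀ {n} k → k ≤ n → count (λ (c : Fin n) → toℕ c <? k) ≡ k
count-toℕ< {n} zero _ = count-∅ (λ (c : Fin n) → toℕ c <? zero) (λ c ())
count-toℕ< {suc n} (suc k) (s≤s k≤n) = cong suc (trans
  (count-cong (λ (c : Fin n) → suc (toℕ c) <? suc k) (λ c → toℕ c <? k) (λ c → mk⇔ s<s⁻¹ s<s))
  (count-toℕ< k k≤n))

count-≟ : ∀ {n} (d : Fin n) → count (_≟ d) ≡ 1
count-≟ {suc n} zero = cong suc (count-∅ (λ (c : Fin n) → suc c ≟ zero) (λ c ()))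
count-≟ {suc n} (suc d) = trans
  (count-cong (λ (c : Fin n) → suc c ≟ suc d) (_≟ d) (λ c → mk⇔ suc-injective (cong suc)))
  (count-≟ d)

m∸n<m∸o⇔o<n : ∀ {m n o} → n ≤ m → (m ∸ n < m ∸ o) ⇔ (o < n)
m∸n<m∸o⇔o<n n≤m = mk⇔ (λ lt → ≰⇒> (λ n≤o → <⇒≱ lt (∸-monoʳ-≤ _ n≤o))) (λ o<n → ∸-monoʳ-< o<n n≤m)

-- The dot of the permutation matrix in column q lies in row n - v(q) + 1.
module _ {n : ℕ} (v : Permutation′ n) where

  dotRow : Fin n → Fin n
  dotRow q = opposite (v ⟨$⟩ʳ q)

  dotColumn : Fin n → Fin n
  dotColumn r = v ⟨$⟩ˡ opposite r

  dotColumn-dotRow : ∀ q → dotColumn (dotRow q) ≡ q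
  dotColumn-dotRow q = trans (cong (v ⟨$⟩ˡ_) (opposite-involutive _)) (inverseˡ v)

  dotRow-dotColumn : ∀ r → dotRow (dotColumn r) ≡ r
  dotRow-dotColumn r = trans (cong opposite (inverseʳ v)) (opposite-involutive r)

  val-injective : ∀ {p q} → val v p ≡ val v q → p ≡ q
  val-injective = Injection.injective (↔⇒↣ v) ∘ toℕ-injective ∘ ℕₚ.suc-injective

  dotRow-antitone : ∀ {p q} → val v p ≤ val v q → toℕ (dotRow q) ≤ toℕ (dotRow p)
  dotRow-antitone {p} {q} vp≤vq =
    subst₂ _≤_ (sym (opposite-prop (v ⟨$⟩ʳ q))) (sym (opposite-prop (v ⟨$⟩ʳ p))) (∸-monoʳ-≤ n vp≤vq)

  InD-dotRow : ∀ q c → InD v (dotRow q) c ⇔ (toℕ c < toℕ q × val v c < val v q)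
  InD-dotRow q c = mk⇔
    (λ (below , left) → s<s⁻¹ (subst (λ x → num c < num x) (dotColumn-dotRow q) left) , to rowBound below)
    (λ (c<q , vc<vq) → from rowBound vc<vq , subst (λ x → num c < num x) (sym (dotColumn-dotRow q)) (s<s c<q))
    where
    rowBound : num (dotRow q) < (n ∸ val v c) + 1 ⇔ val v c < val v q
    rowBound rewrite opposite-prop (v ⟨$⟩ʳ q) | +-comm (n ∸ val v c) 1 =
      mk⇔ (to (m∸n<m∸o⇔o<n (toℕ<n (v ⟨$⟩ʳ q))) ∘ s<s⁻¹) (s<s ∘ from (m∸n<m∸o⇔o<n (toℕ<n (v ⟨$⟩ʳ q))))

  InD⇒dotColumn : ∀ {r c} → InD v r c → toℕ c < toℕ (dotColumn r) × val v c < val v (dotColumn r)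
  InD⇒dotColumn {r} {c} box = to (InD-dotRow (dotColumn r) c) (subst (λ x → InD v x c) (sym (dotRow-dotColumn r)) box)

module AfterLastAscent {n : ℕ} (v : Permutation′ n) (i d : Fin n) (d≡1+i : toℕ d ≡ suc (toℕ i))
    (i↗d : val v i < val v d) (last : ∀ c → IsAscent v c → toℕ c ≤ toℕ i) where

  i<d : toℕ i < toℕ d
  i<d = ≤-reflexive (sym d≡1+i)

  descent-step : ∀ {p q} → toℕ i < toℕ p → toℕ q ≡ suc (toℕ p) → val v q < val v p
  descent-step {p} {q} i<p q≡1+p = ≰⇒> no-ascent-at-p
    where
    no-ascent-at-p : ¬ val v p ≤ val v q
    no-ascent-at-p vp≤vq with m≤n⇒m<n∨m≡n vp≤vq
    ... | inj₁ vp<vq = <⇒≱ i<p (last p (q , q≡1+p , vp<vq))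
    ... | inj₂ vp≡vq = 1+n≢n (trans (sym q≡1+p) (cong toℕ (sym (val-injective v vp≡vq))))

  descending : ∀ {p q} → toℕ i < toℕ p → toℕ p < toℕ q → val v q < val v p
  descending {p} i<p p<q = go (≤⇒≤′ p<q) refl
    where
    go : ∀ {m q} → suc (toℕ p) ≤′ m → toℕ q ≡ m → val v q < val v p
    go ≤′-refl q≡1+p = descent-step i<p q≡1+p
    go {suc m} {q} (≤′-step 1+p≤m) q≡1+m =
      <-trans (descent-step i<q′ (trans q≡1+m (cong suc (sym q′≡m)))) (go 1+p≤m q′≡m)
      where
      m<n : m < n
      m<n = <-trans (n<1+n m) (subst (_< n) q≡1+m (toℕ<n q))
      q′ : Fin n
      q′ = fromℕ< m<n
      q′≡m : toℕ q′ ≡ m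
      q′≡m = toℕ-fromℕ< m<n
      i<q′ : toℕ i < toℕ q′
      i<q′ = subst (toℕ i <_) (sym q′≡m) (<-trans i<p (≤′⇒≤ 1+p≤m))

  val-≤-beyond : ∀ {q} → toℕ i < toℕ q → val v q ≤ val v d
  val-≤-beyond {q} i<q with m≤n⇒m<n∨m≡n (subst (_≤ toℕ q) (sym d≡1+i) i<q)
  ... | inj₁ d<q = <⇒≤ (descending i<d d<q)
  ... | inj₂ d≡q = ≤-reflexive (cong (val v) (sym (toℕ-injective d≡q)))

  corner : InD v (dotRow v d) i
  corner = from (InD-dotRow v d i) (i<d , i↗d)

  rightmost : ∀ r c → InD v r c → toℕ c ≤ toℕ i
  rightmost r c box with InD⇒dotColumn v box
  ... | c<q , vc<vq = ≮⇒≥ (λ i<c → <-asym vc<vq (descending i<c c<q))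

  southmost : ∀ r → InD v r i → toℕ (dotRow v d) ≤ toℕ r
  southmost r box = subst (toℕ (dotRow v d) ≤_) (cong toℕ (dotRow-dotColumn v r))
    (dotRow-antitone v (val-≤-beyond (proj₁ (InD⇒dotColumn v box))))

  left? : Decidable (λ (c : Fin n) → toℕ c < toℕ i)
  left? c = toℕ c <? toℕ i

  smaller? : Decidable (λ c → val v c < val v d)
  smaller? c = val v c <? val v d

  boxesLeft-corner : boxesLeft v (dotRow v d) i ≡ count (smaller? ∩? left?)
  boxesLeft-corner = trans (length-filter-tabulate (left? ∩? InD? v (dotRow v d)) (λ c → c))
    (count-cong (left? ∩? InD? v (dotRow v d)) (smaller? ∩? left?) λ c → mk⇔
      (λ (c<i , box) → proj₂ (to (InD-dotRow v d c) box) , c<i)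
      (λ (vc<vd , c<i) → c<i , from (InD-dotRow v d c) (<-trans c<i i<d , vc<vd)))

  count-smaller : count smaller? ≡ toℕ (v ⟨$⟩ʳ d)
  count-smaller = begin
    count smaller?              ≡⟨ count-cong smaller? (below? ∘ (v ⟨$⟩ʳ_)) (λ _ → mk⇔ s<s⁻¹ s<s) ⟩
    count (below? ∘ (v ⟨$⟩ʳ_))  ≡⟨ count-permute below? v ⟩
    count below?                ≡⟨ count-toℕ< _ (<⇒≤ (toℕ<n (v ⟨$⟩ʳ d))) ⟩
    toℕ (v ⟨$⟩ʳ d)               ∎
    where
    open ≡-Reasoning
    below? : Decidable (λ (y : Fin n) → toℕ y < toℕ (v ⟨$⟩ʳ d))
    below? y = toℕ y <? toℕ (v ⟨$⟩ʳ d)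

  only-d-from-i-not-smaller : ∀ c → (¬ toℕ c < toℕ i × ¬ val v c < val v d) ⇔ c ≡ d
  only-d-from-i-not-smaller c = mk⇔ to-d (λ { refl → <-asym i<d , <-irrefl refl })
    where
    to-d : ¬ toℕ c < toℕ i × ¬ val v c < val v d → c ≡ d
    to-d (c≮i , vc≮vd) with m≤n⇒m<n∨m≡n (≮⇒≥ c≮i)
    ... | inj₁ i<c = val-injective v (≤-antisym (val-≤-beyond i<c) (≮⇒≥ vc≮vd))
    ... | inj₂ i≡c = ⊥-elim (vc≮vd (subst (λ x → val v x < val v d) (toℕ-injective i≡c) i↗d))

  count-from-i : count (∁? left?) ≡ suc (count (∁? left? ∩? smaller?))
  count-from-i = begin
    count (∁? left?)                                            ≡⟨ count-partition (∁? left?) smaller? ⟩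
    count (∁? left? ∩? smaller?) + count (∁? left? ∩? ∁? smaller?) ≡⟨ cong (count (∁? left? ∩? smaller?) +_) count-d ⟩
    count (∁? left? ∩? smaller?) + 1                             ≡⟨ +-comm _ 1 ⟩
    suc (count (∁? left? ∩? smaller?))                          ∎
    where
    open ≡-Reasoning
    count-d : count (∁? left? ∩? ∁? smaller?) ≡ 1
    count-d = trans (count-cong (∁? left? ∩? ∁? smaller?) (_≟ d) only-d-from-i-not-smaller) (count-≟ d)

  label : canonicalLabel v (dotRow v d) i ≡ num i
  label = cong suc (+-cancelʳ-≡ (suc M) _ _ (begin
    toℕ (dotRow v d) + K + suc M      ≡⟨ +-assoc (toℕ (dotRow v d)) K (suc M) ⟩
    toℕ (dotRow v d) + (K + suc M)    ≡⟨ cong (toℕ (dotRow v d) +_) (trans (+-suc K M) (cong suc K+M≡Y)) ⟩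
    toℕ (dotRow v d) + suc Y          ≡⟨ cong (_+ suc Y) (opposite-prop (v ⟨$⟩ʳ d)) ⟩
    n ∸ suc Y + suc Y                ≡⟨ m∸n+n≡m (toℕ<n (v ⟨$⟩ʳ d)) ⟩
    n                                ≡⟨ sym i+1+M≡n ⟩
    toℕ i + suc M                    ∎))
    where
    open ≡-Reasoning
    K M Y : ℕ
    K = boxesLeft v (dotRow v d) i
    M = count (∁? left? ∩? smaller?)
    Y = toℕ (v ⟨$⟩ʳ d)
    K+M≡Y : K + M ≡ Y
    K+M≡Y = begin
      K + M                                                    ≡⟨ cong₂ _+_ boxesLeft-corner (count-cong (∁? left? ∩? smaller?) (smaller? ∩? ∁? left?) (λ _ → mk⇔ swap swap)) ⟩
      count (smaller? ∩? left?) + count (smaller? ∩? ∁? left?) ≡⟨ count-partition smaller? left? ⟨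
      count smaller?                                           ≡⟨ count-smaller ⟩
      Y                                                        ∎
    i+1+M≡n : toℕ i + suc M ≡ n
    i+1+M≡n = trans (cong₂ _+_ (sym (count-toℕ< (toℕ i) (<⇒≤ (toℕ<n i)))) (sym count-from-i)) (count-∁ left?)

lemma6p6 : (n : ℕ) (v : Permutation′ n) (i : Fin n) → IsLastAscent v i →
    Σ (Fin n) (λ r →
      InD v r i
      × (∀ (r′ c′ : Fin n) → InD v r′ c′ → toℕ c′ ≤ toℕ i)
      × (∀ (r′ : Fin n) → InD v r′ i → toℕ r ≤ toℕ r′)
      × (canonicalLabel v r i ≡ num i))
lemma6p6 n v i ((d , d≡1+i , i↗d) , last) = dotRow v d , corner , rightmost , southmost , label
  where open AfterLastAscent v i d d≡1+i i↗d last
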